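{- Let $\pi_1,\pi_2,\dots$ be nonzero parameters, put $\beta_r=\pi_r^{ -1}$, and let $u_j$ be the pushing operators with these parameters. Then for every partition $\mu$ and every finite sequence $(j_1,\dots,j_k)$ of positive integers, $u_{j_1}u_{j_2}\cdots u_{j_k}\cdot\mu=\dfrac{\pi_{j_1}\pi_{j_2}\cdots\pi_{j_k}}{\boldsymbol{\pi}^{\lambda/\mu}}\cdot\lambda$, where $\lambda$ is the partition of which $u_{j_1}\cdots u_{j_k}\cdot\mu$ is a scalar multiple.
   Context: $\mathcal{P}$ is the set of partitions (infinite weakly decreasing sequences of nonnegative integers with finitely many nonzero terms) and $\mathbf{k}[\mathcal{P}]$ the vector space with basis $\mathcal{P}$ over a field $\mathbf{k}$ of characteristic $0$ containing the parameters. For parameters $\beta_1,\beta_2,\dots$ and $j\ge1$, the pushing operator $u_j$ is defined by: for a partition $\mu$, let $k\le j$ be minimal with $\mu_k=\mu_j$, let $\nu$ be obtained from $\mu$ by adding one box to each of rows $k,\dots,j$, and set $u_j\cdot\mu=\beta_k\cdots\beta_{j-1}\,\nu$ (empty product $=1$). Notation: $\boldsymbol{\pi}^{\lambda/\mu}=\prod_r\pi_r^{\lambda_r-\mu_r}$. -}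

module Defs where

open import Level using (Level)
open import Algebra.Bundles using (CommutativeRing)
open import Data.Nat using (ℕ; zero; suc; _≤_; _<_; _∸_; _≤ᵇ_) renaming (_+_ to _+ℕ_)
open import Data.Nat.Properties using (_≟_)
open import Data.Bool using (Bool; true; false; if_then_else_; _∧_)
open import Data.List using (List; []; _∷_; map; foldr; upTo)
open import Data.Product using (_×_; _,_; ∃; proj₁; proj₂)
open import Relation.Nullary using (¬_)
open import Relation.Nullary.Decidable using (⌊_⌋)
open import Relation.Binary.PropositionalEquality using (_≡_)

-- CONVENTION: rows and parameter indices are 0-based here:
-- row r / parameter index r in Agda corresponds to row r+1 / index r+1 in the paper.

IsPartition : (ℕ → ℕ) → Set
IsPartition μ = (∀ i → μ (suc i) ≤ μ i) × ∃ λ N → ∀ i → N ≤ i → μ i ≡ 0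

firstFrom : (ℕ → Bool) → ℕ → ℕ → ℕ
firstFrom p s zero = s
firstFrom p s (suc n) = if p s then s else firstFrom p (suc s) n

minIdx : (ℕ → ℕ) → ℕ → ℕ
minIdx μ j = firstFrom (λ k → ⌊ μ k ≟ μ j ⌋) 0 j

range : ℕ → ℕ → List ℕ
range k j = map (k +ℕ_) (upTo (j ∸ k))

module _ {c ℓ : Level} (R : CommutativeRing c ℓ) where
  open CommutativeRing R

  IsField : Set (c Level.⊔ ℓ)
  IsField = (¬ (0# ≈ 1#)) × (∀ x → ¬ (x ≈ 0#) → ∃ λ y → x * y ≈ 1#)

  natCast : ℕ → Carrier
  natCast zero = 0#
  natCast (suc n) = 1# + natCast n

  CharZero : Set ℓ
  CharZero = ∀ n → ¬ (natCast (suc n) ≈ 0#)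

  prod : List Carrier → Carrier
  prod = foldr _*_ 1#

  pow : Carrier → ℕ → Carrier
  pow x zero = 1#
  pow x (suc n) = x * pow x n

  -- The pushing operator u_j (0-based j) with parameters β, acting on a basis
  -- element μ; the result scalar · ν is returned as the pair (scalar , ν).
  push : (β : ℕ → Carrier) → ℕ → (ℕ → ℕ) → Carrier × (ℕ → ℕ)
  push β j μ =
    let k = minIdx μ j in
    ( prod (map β (range k j))
    , λ i → if (k ≤ᵇ i) ∧ (i ≤ᵇ j) then suc (μ i) else μ i )

  -- u_{j₁} u_{j₂} ⋯ u_{j_k} · μ  for the list j₁ ∷ j₂ ∷ ⋯ ∷ j_k ∷ []
  -- (u_{j_k} is applied first; operators are linear, so scalars multiply).
  pushSeq : (β : ℕ → Carrier) → List ℕ → (ℕ → ℕ) → Carrier × (ℕ → ℕ)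
  pushSeq β [] μ = (1# , μ)
  pushSeq β (j ∷ js) μ =
    let r = pushSeq β js μ
        s = push β j (proj₂ r)
    in (proj₁ s * proj₁ r , proj₂ s)

  -- π^{λ/μ} restricted to rows r < N, with the exponents negated:
  -- ∏_{r<N} β_r^{λ_r - μ_r}
  invMono : (β : ℕ → Carrier) → (ℕ → ℕ) → (ℕ → ℕ) → ℕ → Carrier
  invMono β λ' μ N = prod (map (λ r → pow (β r) (λ' r ∸ μ r)) (upTo N))

{-# OPTIONS --safe #-}
-- A single u_j adds one box to each of rows k, …, j and carries the scalar β_k ⋯ β_{j-1},
-- which is π_j · β_k ⋯ β_j: π_j times the β-monomial of the boxes just added. Along a chain
-- μ ⊆ ν ⊆ λ the exponents λ_r − ν_r and ν_r − μ_r add up, so these monomials multiply, and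
-- induction on the word j₁ ⋯ j_k gives the formula.
module Submission where

open import Defs
open import Level using (Level)
open import Algebra.Bundles using (CommutativeRing)
open import Data.Nat using (ℕ; zero; suc; _≤_; _<_; _≤ᵇ_; _∸_; z≤n; s≤s) renaming (_+_ to _+ℕ_)
open import Data.Nat.Properties
  using (_≤?_; ≤-refl; ≤-trans; <⇒≤; <⇒≱; n≤1+n; m≤m+n; +-suc; +-∸-assoc; m∸n+n≡m;
         m+[n∸m]≡n; m+n∸n≡m; n∸n≡0; +-monoʳ-≤)
open import Data.List using (List; []; _∷_; map; upTo; applyUpTo)
open import Data.List.Properties using (map-upTo; map-∘)
open import Data.List.Relation.Unary.All using (All; []; _∷_)
open import Data.Product using (_×_; _,_; proj₁; proj₂)
open import Data.Bool using (true; false; if_then_else_; _∧_)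
open import Function using (_∘_)
open import Relation.Nullary using (¬_)
open import Relation.Nullary.Decidable using (dec-true; dec-false)
open import Relation.Binary.PropositionalEquality as ≡ using (_≡_)
import Algebra.Properties.CommutativeSemigroup as CommutativeSemigroupProperties

≤ᵇ-true : ∀ {m n} → m ≤ n → (m ≤ᵇ n) ≡ true
≤ᵇ-true = dec-true (_ ≤? _)

≤ᵇ-false : ∀ {m n} → ¬ m ≤ n → (m ≤ᵇ n) ≡ false
≤ᵇ-false = dec-false (_ ≤? _)

∸-split : ∀ {m n p} → m ≤ n → n ≤ p → p ∸ m ≡ (p ∸ n) +ℕ (n ∸ m)
∸-split {m} {n} {p} m≤n n≤p = ≡.trans (≡.cong (_∸ m) (≡.sym (m∸n+n≡m n≤p))) (+-∸-assoc (p ∸ n) m≤n)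

firstFrom-≤ : ∀ p s n → firstFrom p s n ≤ s +ℕ n
firstFrom-≤ p s zero = m≤m+n s 0
firstFrom-≤ p s (suc n) with p s
... | true = m≤m+n s (suc n)
... | false = ≡.subst (firstFrom p (suc s) n ≤_) (≡.sym (+-suc s n)) (firstFrom-≤ p (suc s) n)

minIdx-≤ : ∀ μ j → minIdx μ j ≤ j
minIdx-≤ μ j = firstFrom-≤ _ 0 j

-- `proj₂ (push R β j μ)` is definitionally `addBoxes μ (minIdx μ j) j`.
addBoxes : (ℕ → ℕ) → ℕ → ℕ → ℕ → ℕ
addBoxes μ k j i = if (k ≤ᵇ i) ∧ (i ≤ᵇ j) then suc (μ i) else μ i

addBoxes-grows : ∀ μ k j i → μ i ≤ addBoxes μ k j i
addBoxes-grows μ k j i with (k ≤ᵇ i) ∧ (i ≤ᵇ j)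
... | true = n≤1+n (μ i)
... | false = ≤-refl

addBoxes-inside : ∀ μ {k j i} → k ≤ i → i ≤ j → addBoxes μ k j i ∸ μ i ≡ 1
addBoxes-inside μ {k} {j} {i} k≤i i≤j rewrite ≤ᵇ-true k≤i | ≤ᵇ-true i≤j = m+n∸n≡m 1 (μ i)

addBoxes-below : ∀ μ {k j i} → i < k → addBoxes μ k j i ∸ μ i ≡ 0
addBoxes-below μ {k} {j} {i} i<k rewrite ≤ᵇ-false (<⇒≱ i<k) = n∸n≡0 (μ i)

addBoxes-above : ∀ μ {k j i} → k ≤ j → j < i → addBoxes μ k j i ∸ μ i ≡ 0
addBoxes-above μ {k} {j} {i} k≤j j<i
  rewrite ≤ᵇ-true (≤-trans k≤j (<⇒≤ j<i)) | ≤ᵇ-false (<⇒≱ j<i) = n∸n≡0 (μ i)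

module _ {c ℓ : Level} (R : CommutativeRing c ℓ) where
  open CommutativeRing R
  open CommutativeSemigroupProperties *-commutativeSemigroup using (interchange; x∙yz≈y∙xz)
  open import Relation.Binary.Reasoning.Setoid setoid

  ∏ : (ℕ → Carrier) → ℕ → Carrier
  ∏ f n = prod R (applyUpTo f n)

  prod-map-upTo : ∀ f n → prod R (map f (upTo n)) ≡ ∏ f n
  prod-map-upTo f n = ≡.cong (prod R) (map-upTo f n)

  ∏-cong : ∀ {f g} n → (∀ r → r < n → f r ≈ g r) → ∏ f n ≈ ∏ g n
  ∏-cong zero f≈g = refl
  ∏-cong (suc n) f≈g = *-cong (f≈g 0 (s≤s z≤n)) (∏-cong n (λ r r<n → f≈g (suc r) (s≤s r<n)))

  ∏-ones : ∀ {f} n → (∀ r → r < n → f r ≈ 1#) → ∏ f n ≈ 1#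
  ∏-ones zero f≈1 = refl
  ∏-ones (suc n) f≈1 =
    trans (*-cong (f≈1 0 (s≤s z≤n)) (∏-ones n (λ r r<n → f≈1 (suc r) (s≤s r<n)))) (*-identityˡ 1#)

  ∏-* : ∀ f g n → ∏ (λ r → f r * g r) n ≈ ∏ f n * ∏ g n
  ∏-* f g zero = sym (*-identityˡ 1#)
  ∏-* f g (suc n) = trans (*-cong refl (∏-* (f ∘ suc) (g ∘ suc) n)) (interchange _ _ _ _)

  ∏-+ : ∀ f m n → ∏ f (m +ℕ n) ≈ ∏ f m * ∏ (f ∘ (m +ℕ_)) n
  ∏-+ f zero n = sym (*-identityˡ _)
  ∏-+ f (suc m) n = trans (*-cong refl (∏-+ (f ∘ suc) m n)) (sym (*-assoc _ _ _))

  ∏-suc : ∀ f n → ∏ f (suc n) ≈ ∏ f n * f n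
  ∏-suc f zero = trans (*-identityʳ _) (sym (*-identityˡ _))
  ∏-suc f (suc n) = trans (*-cong refl (∏-suc (f ∘ suc) n)) (sym (*-assoc _ _ _))

  ∏-supported : ∀ g k n t → (∀ r → r < k → g r ≈ 1#) → (∀ r → g (k +ℕ n +ℕ r) ≈ 1#) →
    ∏ g (k +ℕ n +ℕ t) ≈ ∏ (g ∘ (k +ℕ_)) n
  ∏-supported g k n t below above = begin
    ∏ g (k +ℕ n +ℕ t)                                ≈⟨ ∏-+ g (k +ℕ n) t ⟩
    ∏ g (k +ℕ n) * ∏ (g ∘ (k +ℕ n +ℕ_)) t            ≈⟨ *-cong (∏-+ g k n) (∏-ones t (λ r _ → above r)) ⟩
    (∏ g k * ∏ (g ∘ (k +ℕ_)) n) * 1#                 ≈⟨ *-identityʳ _ ⟩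
    ∏ g k * ∏ (g ∘ (k +ℕ_)) n                        ≈⟨ *-cong (∏-ones k below) refl ⟩
    1# * ∏ (g ∘ (k +ℕ_)) n                           ≈⟨ *-identityˡ _ ⟩
    ∏ (g ∘ (k +ℕ_)) n                                ∎

  pow-+ : ∀ x m n → pow R x (m +ℕ n) ≈ pow R x m * pow R x n
  pow-+ x zero n = sym (*-identityˡ _)
  pow-+ x (suc m) n = trans (*-cong refl (pow-+ x m n)) (sym (*-assoc _ _ _))

  invMono-∏ : ∀ β λ' μ N → invMono R β λ' μ N ≡ ∏ (λ r → pow R (β r) (λ' r ∸ μ r)) N
  invMono-∏ β λ' μ N = prod-map-upTo _ N

  invMono-refl : ∀ β μ N → invMono R β μ μ N ≈ 1#
  invMono-refl β μ N = trans (reflexive (invMono-∏ β μ μ N))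
    (∏-ones N (λ r _ → reflexive (≡.cong (pow R (β r)) (n∸n≡0 (μ r)))))

  invMono-trans : ∀ β {μ ν λ'} N → (∀ i → μ i ≤ ν i) → (∀ i → ν i ≤ λ' i) →
    invMono R β λ' μ N ≈ invMono R β λ' ν N * invMono R β ν μ N
  invMono-trans β {μ} {ν} {λ'} N μ≤ν ν≤λ = begin
    invMono R β λ' μ N                                   ≡⟨ invMono-∏ β λ' μ N ⟩
    ∏ (λ r → pow R (β r) (λ' r ∸ μ r)) N                 ≈⟨ ∏-cong N (λ r _ → powSplit r) ⟩
    ∏ (λ r → pow R (β r) (λ' r ∸ ν r) * pow R (β r) (ν r ∸ μ r)) N
                                                         ≈⟨ ∏-* _ _ N ⟩
    ∏ (λ r → pow R (β r) (λ' r ∸ ν r)) N * ∏ (λ r → pow R (β r) (ν r ∸ μ r)) N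
                                                         ≡⟨ ≡.sym (≡.cong₂ _*_ (invMono-∏ β λ' ν N) (invMono-∏ β ν μ N)) ⟩
    invMono R β λ' ν N * invMono R β ν μ N               ∎
    where
    powSplit : ∀ r → pow R (β r) (λ' r ∸ μ r) ≈ pow R (β r) (λ' r ∸ ν r) * pow R (β r) (ν r ∸ μ r)
    powSplit r = trans (reflexive (≡.cong (pow R (β r)) (∸-split (μ≤ν r) (ν≤λ r)))) (pow-+ (β r) (λ' r ∸ ν r) (ν r ∸ μ r))

  invMono-addBoxes : ∀ β μ {k j} N → k ≤ j → j < N →
    invMono R β (addBoxes μ k j) μ N ≈ prod R (map β (range k j)) * β j
  invMono-addBoxes β μ {k} {j} N k≤j j<N = begin
    invMono R β (addBoxes μ k j) μ N             ≡⟨ invMono-∏ β (addBoxes μ k j) μ N ⟩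
    ∏ w N                                        ≡⟨ ≡.cong (∏ w) (≡.sym N≡k+[m+1]+t) ⟩
    ∏ w (k +ℕ suc m +ℕ t)                        ≈⟨ ∏-supported w k (suc m) t below above ⟩
    ∏ (w ∘ (k +ℕ_)) (suc m)                      ≈⟨ ∏-suc (w ∘ (k +ℕ_)) m ⟩
    ∏ (w ∘ (k +ℕ_)) m * w (k +ℕ m)               ≈⟨ *-cong (∏-cong m (λ r r<m → inside (inWindow r<m))) lastRow ⟩
    ∏ (β ∘ (k +ℕ_)) m * β j                      ≡⟨ ≡.cong (_* β j) (≡.sym rangeProduct) ⟩
    prod R (map β (range k j)) * β j             ∎
    where
    m = j ∸ k
    t = N ∸ suc j
    w : ℕ → Carrier
    w r = pow R (β r) (addBoxes μ k j r ∸ μ r)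
    k+m≡j : k +ℕ m ≡ j
    k+m≡j = m+[n∸m]≡n k≤j
    k+[m+1]≡j+1 : k +ℕ suc m ≡ suc j
    k+[m+1]≡j+1 = ≡.trans (+-suc k m) (≡.cong suc k+m≡j)
    N≡k+[m+1]+t : k +ℕ suc m +ℕ t ≡ N
    N≡k+[m+1]+t = ≡.trans (≡.cong (_+ℕ t) k+[m+1]≡j+1) (m+[n∸m]≡n j<N)
    inWindow : ∀ {r} → r < m → k ≤ k +ℕ r × k +ℕ r ≤ j
    inWindow {r} r<m = m≤m+n k r , ≡.subst (k +ℕ r ≤_) k+m≡j (+-monoʳ-≤ k (<⇒≤ r<m))
    below : ∀ r → r < k → w r ≈ 1#
    below r r<k = reflexive (≡.cong (pow R (β r)) (addBoxes-below μ r<k))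
    above : ∀ r → w (k +ℕ suc m +ℕ r) ≈ 1#
    above r = reflexive (≡.cong (pow R (β _)) (addBoxes-above μ k≤j
      (≡.subst (λ x → j < x +ℕ r) (≡.sym k+[m+1]≡j+1) (s≤s (m≤m+n j r)))))
    inside : ∀ {r} → k ≤ r × r ≤ j → w r ≈ β r
    inside (k≤r , r≤j) = trans (reflexive (≡.cong (pow R (β _)) (addBoxes-inside μ k≤r r≤j))) (*-identityʳ _)
    lastRow : w (k +ℕ m) ≈ β j
    lastRow = trans (inside (m≤m+n k m , ≡.subst (_≤ j) (≡.sym k+m≡j) ≤-refl)) (reflexive (≡.cong β k+m≡j))
    rangeProduct : prod R (map β (range k j)) ≡ ∏ (β ∘ (k +ℕ_)) m
    rangeProduct = ≡.trans (≡.cong (prod R) (≡.sym (map-∘ (upTo m)))) (prod-map-upTo _ m)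

  push-scalar : ∀ (π β : ℕ → Carrier) j μ N → π j * β j ≈ 1# → j < N →
    proj₁ (push R β j μ) ≈ π j * invMono R β (proj₂ (push R β j μ)) μ N
  push-scalar π β j μ N πβ≈1 j<N = sym (begin
    π j * invMono R β (addBoxes μ k j) μ N      ≈⟨ *-cong refl (invMono-addBoxes β μ N (minIdx-≤ μ j) j<N) ⟩
    π j * (βs * β j)                            ≈⟨ x∙yz≈y∙xz (π j) βs (β j) ⟩
    βs * (π j * β j)                            ≈⟨ *-cong refl πβ≈1 ⟩
    βs * 1#                                     ≈⟨ *-identityʳ βs ⟩
    βs                                          ∎)
    where
    k = minIdx μ j
    βs = prod R (map β (range k j))

  pushSeq-grows : ∀ β js μ i → μ i ≤ proj₂ (pushSeq R β js μ) i
  pushSeq-grows β [] μ i = ≤-refl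
  pushSeq-grows β (j ∷ js) μ i =
    ≤-trans (pushSeq-grows β js μ i) (addBoxes-grows ν (minIdx ν j) j i)
    where ν = proj₂ (pushSeq R β js μ)

  pushSeq-scalar : ∀ (π β : ℕ → Carrier) → (∀ r → π r * β r ≈ 1#) → ∀ μ js N → All (_< N) js →
    proj₁ (pushSeq R β js μ) ≈ prod R (map π js) * invMono R β (proj₂ (pushSeq R β js μ)) μ N
  pushSeq-scalar π β πβ≈1 μ [] N [] = sym (trans (*-identityˡ _) (invMono-refl β μ N))
  pushSeq-scalar π β πβ≈1 μ (j ∷ js) N (j<N ∷ js<N) = begin
    proj₁ (push R β j ν) * proj₁ (pushSeq R β js μ)
      ≈⟨ *-cong (push-scalar π β j ν N (πβ≈1 j) j<N) (pushSeq-scalar π β πβ≈1 μ js N js<N) ⟩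
    (π j * invMono R β λ' ν N) * (prod R (map π js) * invMono R β ν μ N)
      ≈⟨ interchange _ _ _ _ ⟩
    (π j * prod R (map π js)) * (invMono R β λ' ν N * invMono R β ν μ N)
      ≈⟨ *-cong refl (sym (invMono-trans β N (pushSeq-grows β js μ) (addBoxes-grows ν (minIdx ν j) j))) ⟩
    (π j * prod R (map π js)) * invMono R β λ' μ N
      ∎
    where
    ν = proj₂ (pushSeq R β js μ)
    λ' = proj₂ (push R β j ν)

lemma4p2 : {c ℓ : Level} (R : CommutativeRing c ℓ) → IsField R → CharZero R →
    (π β : ℕ → CommutativeRing.Carrier R) →
    (∀ r → ¬ (CommutativeRing._≈_ R (π r) (CommutativeRing.0# R))) →
    (∀ r → CommutativeRing._≈_ R (CommutativeRing._*_ R (π r) (β r)) (CommutativeRing.1# R)) →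
    (μ : ℕ → ℕ) → IsPartition μ → (js : List ℕ) →
    (N : ℕ) → All (_< N) js →
    CommutativeRing._≈_ R (proj₁ (pushSeq R β js μ))
      (CommutativeRing._*_ R (prod R (map π js)) (invMono R β (proj₂ (pushSeq R β js μ)) μ N))
lemma4p2 R _ _ π β _ πβ≈1 μ _ js N js<N = pushSeq-scalar R π β πβ≈1 μ js N js<N
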